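{- Let $n>1$ be an integer and let $G$ be a tree of order $m\ge 3$. Then $\chi_{ld}(G[\overline{K_n}])=2$ if and only if $G$ is a star $K_{1,m-1}$.
   Context: For a graph $G=(V,E)$ of order $N$ and a bijection $f\colon V\to\{1,\dots,N\}$, the weight of a vertex $u$ is $w(u)=\sum_{x\in N(u)}f(x)$, where $N(u)$ is the open neighborhood of $u$. The bijection $f$ is a local distance antimagic labeling if $w(u)\neq w(v)$ for every edge $uv$. $\chi_{ld}(G)$ is the minimum number of distinct weights over all local distance antimagic labelings of $G$. $\overline{K_n}$ is the edgeless graph on $n$ vertices. The lexicographic product $G[H]$ has vertex set $V(G)\times V(H)$, with $(g,h)$ adjacent to $(g',h')$ iff $gg'\in E(G)$, or $g=g'$ and $hh'\in E(H)$. -}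

module Defs where

open import Data.Nat using (ℕ; zero; suc; _+_; _*_; _≤_; _≟_)
open import Data.Fin using (Fin; toℕ; quotient) renaming (zero to fzero; _≟_ to _≟ᶠ_)
open import Data.Fin.Permutation using (Permutation′; _⟨$⟩ʳ_)
open import Data.Bool using (Bool; true; false; if_then_else_; _∧_; _∨_; not)
open import Data.List using (List; []; _∷_; length; deduplicate; allFin; map)
open import Data.List.Relation.Unary.Unique.Propositional using (Unique)
open import Data.Product using (Σ; _×_; _,_; ∃)
open import Relation.Binary.PropositionalEquality using (_≡_; _≢_)
open import Relation.Nullary using (¬_; does)

record Graph (N : ℕ) : Set where
  field
    Adj    : Fin N → Fin N → Bool
    sym    : ∀ i j → Adj i j ≡ Adj j i
    irrefl : ∀ i → Adj i i ≡ false
open Graph public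

data Walk {N : ℕ} (G : Graph N) : Fin N → Fin N → Set where
  here : ∀ {u} → Walk G u u
  step : ∀ {u v w} → Adj G u v ≡ true → Walk G v w → Walk G u w

Connected : ∀ {N} → Graph N → Set
Connected G = ∀ u v → Walk G u v

Chain : ∀ {N} → Graph N → Fin N → List (Fin N) → Set
Chain G u [] = Data.Unit.⊤ where import Data.Unit
Chain G u (v ∷ vs) = (Adj G u v ≡ true) × Chain G v vs

lastOf : ∀ {N} → Fin N → List (Fin N) → Fin N
lastOf u [] = u
lastOf u (v ∷ vs) = lastOf v vs

-- A cycle: distinct vertices v₀,…,v_k (k ≥ 2, i.e. at least 3 vertices),
-- consecutive ones adjacent and v_k adjacent to v₀.
HasCycle : ∀ {N} → Graph N → Set
HasCycle {N} G = Σ (Fin N) λ v₀ → Σ (List (Fin N)) λ vs →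
  (2 ≤ length vs) × Unique (v₀ ∷ vs) × Chain G v₀ vs × (Adj G (lastOf v₀ vs) v₀ ≡ true)

IsTree : ∀ {N} → Graph N → Set
IsTree G = Connected G × ¬ HasCycle G

starAdj : ∀ {m} → Fin m → Fin m → Fin m → Bool
starAdj c i j = not (does (i ≟ᶠ j)) ∧ (does (i ≟ᶠ c) ∨ does (j ≟ᶠ c))

-- G is a star K_{1,m-1}: isomorphic to it, i.e. equal to the star centred
-- at some vertex c (all stars on Fin m with different centres are the
-- relabelings of one another).
IsStar : ∀ {m} → Graph m → Set
IsStar {m} G = Σ (Fin m) λ c → ∀ i j → Adj G i j ≡ starAdj c i j

-- Lexicographic product G[K̄ₙ]: vertex (g,h) encoded in Fin (m * n)
-- via Data.Fin.combine / remQuot; (g,h) ~ (g',h') iff g ~ g' in G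
-- (the second clause of the definition never fires since K̄ₙ is edgeless).
lexEmpty : ∀ {m} → Graph m → (n : ℕ) → Graph (m * n)
lexEmpty {m} G n = record
  { Adj    = λ i j → Adj G (quotient n i) (quotient n j)
  ; sym    = λ i j → sym G (quotient n i) (quotient n j)
  ; irrefl = λ i → irrefl G (quotient n i) }

sumFin : ∀ N → (Fin N → ℕ) → ℕ
sumFin zero f = 0
sumFin (suc N) f = f fzero + sumFin N (λ i → f (Data.Fin.suc i))

-- A labeling is a bijection f : V → {1,…,N}; encoded as a permutation π of
-- Fin N, with label f(x) = 1 + toℕ (π x).
Labeling : ℕ → Set
Labeling N = Permutation′ N

label : ∀ {N} → Labeling N → Fin N → ℕ
label π x = suc (toℕ (π ⟨$⟩ʳ x))

weight : ∀ {N} → Graph N → Labeling N → Fin N → ℕ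
weight {N} G π u = sumFin N (λ x → if Adj G u x then label π x else 0)

IsLDAL : ∀ {N} → Graph N → Labeling N → Set
IsLDAL G π = ∀ u v → Adj G u v ≡ true → weight G π u ≢ weight G π v

numWeights : ∀ {N} → Graph N → Labeling N → ℕ
numWeights {N} G π = length (deduplicate _≟_ (map (weight G π) (allFin N)))

ChiLdIs : ∀ {N} → Graph N → ℕ → Set
ChiLdIs G k =
  (Σ (Labeling _) λ π → IsLDAL G π × numWeights G π ≡ k) ×
  (∀ π → IsLDAL G π → k ≤ numWeights G π)

{-# OPTIONS --safe #-}
-- In G[K̄ₙ] the weight of a vertex (g, h) only depends on g: it is the sum, over the neighbours g′
-- of g, of the label sums of the fibres {g′} × K̄ₙ. If a is a pendant vertex of G with neighbour b,
-- and b c d is a path, then N(a) = {b} ⊊ N(c) forces w(a) < w(c), so a, b, c carry three different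
-- weights. A tree with no such configuration is a star: the end ℓ of a maximal path is pendant, and
-- every neighbour of the vertex next to ℓ must then be pendant as well. Conversely, if the fibre of
-- the centre of a star gets the labels 1, …, n, then every leaf weighs exactly that fibre's label
-- sum, which is less than the weight of the centre, so two weights suffice; any edge forces two.
module Submission where

open import Defs
open import Data.Nat using (ℕ; zero; suc; _+_; _*_; _<_; _≤_; z≤n; s≤s; z<s)
import Data.Nat as ℕ
open import Data.Nat.Properties
  using (≤-refl; ≤-reflexive; ≤-trans; ≤-antisym; <⇒≤; <⇒≢; <-≤-trans; <-irrefl; ≰⇒>; n≤1+n; m≤m+n; m≤n+m;
         +-mono-≤; +-mono-<-≤; +-mono-≤-<; +-identityʳ; +-assoc; +-suc; module ≤-Reasoning)
open import Data.Bool using (Bool; true; false; if_then_else_)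
open import Data.Bool.Properties using (¬-not) renaming (_≟_ to _≟ᵇ_)
open import Data.Empty using (⊥-elim)
open import Data.Fin using (Fin; toℕ; combine; quotient; _↑ˡ_; _↑ʳ_) renaming (zero to 0F; suc to 1+; _<_ to _<ᶠ_)
open import Data.Fin.Properties
  using (remQuot-combine; *↔×; combine-monoˡ-<; pigeonhole; punchInᵢ≢i; any?; suc-injective) renaming (_≟_ to _≟ᶠ_)
open import Data.Fin.Permutation using (Permutation′; _⟨$⟩ʳ_; _⟨$⟩ˡ_; transpose; inverseˡ)
open import Data.List using (List; []; _∷_; length; map; allFin; deduplicate; lookup)
open import Data.List.Membership.Propositional using (_∈_)
open import Data.List.Membership.Propositional.Properties
  using (∈-map⁺; ∈-map⁻; ∈-allFin; ∈-deduplicate⁺; ∈-deduplicate⁻; ∈-lookup)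
open import Data.List.Relation.Binary.Subset.Propositional using (_⊆_)
open import Data.List.Relation.Binary.Subset.Propositional.Properties using (∷⁺ʳ)
open import Data.List.Relation.Unary.All as All using ([]; _∷_)
open import Data.List.Relation.Unary.All.Properties using (¬Any⇒All¬; anti-mono)
open import Data.List.Relation.Unary.AllPairs using ([]; _∷_)
open import Data.List.Relation.Unary.Any using (here; there)
open import Data.List.Relation.Unary.Unique.Propositional using (Unique)
open import Data.List.Relation.Unary.Unique.DecPropositional.Properties ℕ._≟_ using (deduplicate-!)
open import Data.Product using (∃; ∃₂; _×_; _,_; proj₁; proj₂)
open import Data.Product.Function.NonDependent.Propositional using (_×-↔_)
open import Data.Sum using (_⊎_; inj₁; inj₂)
open import Function using (_∘_)
open import Function.Bundles using (_⇔_; mk⇔)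
open import Function.Properties.Inverse using (↔-refl; ↔-sym; ↔-trans)
open import Relation.Nullary using (¬_; Dec; yes; no; does)
open import Relation.Nullary.Decidable using (dec-true; ¬?; _×-dec_; _⊎-dec_)
import Relation.Binary.PropositionalEquality as ≡
open ≡ using (_≡_; _≢_; ≢-sym; refl; cong; subst; subst₂)

private
  variable
    A : Set
    m n N : ℕ

sumFin-cong : ∀ N {f g : Fin N → ℕ} → (∀ x → f x ≡ g x) → sumFin N f ≡ sumFin N g
sumFin-cong zero    _   = refl
sumFin-cong (suc N) f≡g = ≡.cong₂ _+_ (f≡g 0F) (sumFin-cong N (f≡g ∘ 1+))

sumFin-mono-≤ : ∀ N {f g : Fin N → ℕ} → (∀ x → f x ≤ g x) → sumFin N f ≤ sumFin N g
sumFin-mono-≤ zero    _   = z≤n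
sumFin-mono-≤ (suc N) f≤g = +-mono-≤ (f≤g 0F) (sumFin-mono-≤ N (f≤g ∘ 1+))

sumFin-mono-< : ∀ N {f g : Fin N → ℕ} → (∀ x → f x ≤ g x) → ∀ x₀ → f x₀ < g x₀ → sumFin N f < sumFin N g
sumFin-mono-< (suc N) f≤g 0F      f<g = +-mono-<-≤ f<g (sumFin-mono-≤ N (f≤g ∘ 1+))
sumFin-mono-< (suc N) f≤g (1+ x₀) f<g = +-mono-≤-< (f≤g 0F) (sumFin-mono-< N (f≤g ∘ 1+) x₀ f<g)

term≤sumFin : ∀ N (f : Fin N → ℕ) x₀ → f x₀ ≤ sumFin N f
term≤sumFin (suc N) f 0F      = m≤m+n _ _
term≤sumFin (suc N) f (1+ x₀) = ≤-trans (term≤sumFin N (f ∘ 1+) x₀) (m≤n+m _ _)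

sumFin-zero : ∀ N (f : Fin N → ℕ) → (∀ x → f x ≡ 0) → sumFin N f ≡ 0
sumFin-zero zero    f f≡0 = refl
sumFin-zero (suc N) f f≡0 = ≡.cong₂ _+_ (f≡0 0F) (sumFin-zero N (f ∘ 1+) (f≡0 ∘ 1+))

sumFin-single : ∀ N (f : Fin N → ℕ) x₀ → (∀ x → x ≢ x₀ → f x ≡ 0) → sumFin N f ≡ f x₀
sumFin-single (suc N) f 0F f≡0 =
  ≡.trans (cong (f 0F +_) (sumFin-zero N (f ∘ 1+) (λ x → f≡0 (1+ x) (λ ())))) (+-identityʳ _)
sumFin-single (suc N) f (1+ x₀) f≡0 =
  ≡.trans (cong (_+ sumFin N (f ∘ 1+)) (f≡0 0F (λ ())))
          (sumFin-single N (f ∘ 1+) x₀ (λ x x≢x₀ → f≡0 (1+ x) (x≢x₀ ∘ suc-injective)))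

sumFin-++ : ∀ M N (f : Fin (M + N) → ℕ) →
            sumFin (M + N) f ≡ sumFin M (f ∘ (_↑ˡ N)) + sumFin N (f ∘ (M ↑ʳ_))
sumFin-++ zero    N f = refl
sumFin-++ (suc M) N f = ≡.trans (cong (f 0F +_) (sumFin-++ M N (f ∘ 1+))) (≡.sym (+-assoc (f 0F) _ _))

sumFin-combine : ∀ M N (f : Fin (M * N) → ℕ) →
                 sumFin (M * N) f ≡ sumFin M (λ g → sumFin N (λ h → f (combine g h)))
sumFin-combine zero    N f = refl
sumFin-combine (suc M) N f =
  ≡.trans (sumFin-++ N (M * N) f) (cong (sumFin N (f ∘ (_↑ˡ M * N)) +_) (sumFin-combine M N (f ∘ (N ↑ʳ_))))

sumFin-if : ∀ N (b : Bool) (f : Fin N → ℕ) →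
            sumFin N (λ x → if b then f x else 0) ≡ (if b then sumFin N f else 0)
sumFin-if N true  f = refl
sumFin-if N false f = sumFin-zero N _ (λ _ → refl)

∈⇒1≤length : ∀ {a : A} {xs} → a ∈ xs → 1 ≤ length xs
∈⇒1≤length {xs = _ ∷ _} _ = s≤s z≤n

∈-distinct⇒2≤length : ∀ {a b : A} {xs} → a ∈ xs → b ∈ xs → a ≢ b → 2 ≤ length xs
∈-distinct⇒2≤length (here refl) (here refl) a≢b = ⊥-elim (a≢b refl)
∈-distinct⇒2≤length (here refl) (there b∈) _   = s≤s (∈⇒1≤length b∈)
∈-distinct⇒2≤length (there a∈) (here refl) _   = s≤s (∈⇒1≤length a∈)
∈-distinct⇒2≤length (there a∈) (there b∈) a≢b = ≤-trans (∈-distinct⇒2≤length a∈ b∈ a≢b) (n≤1+n _)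

∈-distinct₃⇒3≤length : ∀ {a b c : A} {xs} → a ∈ xs → b ∈ xs → c ∈ xs → a ≢ b → a ≢ c → b ≢ c → 3 ≤ length xs
∈-distinct₃⇒3≤length (here refl) (here refl) _           a≢b _   _   = ⊥-elim (a≢b refl)
∈-distinct₃⇒3≤length (here refl) _           (here refl) _   a≢c _   = ⊥-elim (a≢c refl)
∈-distinct₃⇒3≤length _           (here refl) (here refl) _   _   b≢c = ⊥-elim (b≢c refl)
∈-distinct₃⇒3≤length (here refl) (there b∈)  (there c∈)  _   _   b≢c = s≤s (∈-distinct⇒2≤length b∈ c∈ b≢c)
∈-distinct₃⇒3≤length (there a∈)  (here refl) (there c∈)  _   a≢c _   = s≤s (∈-distinct⇒2≤length a∈ c∈ a≢c)
∈-distinct₃⇒3≤length (there a∈)  (there b∈)  (here refl) a≢b _   _   = s≤s (∈-distinct⇒2≤length a∈ b∈ a≢b)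
∈-distinct₃⇒3≤length (there a∈)  (there b∈)  (there c∈)  a≢b a≢c b≢c =
  ≤-trans (∈-distinct₃⇒3≤length a∈ b∈ c∈ a≢b a≢c b≢c) (n≤1+n _)

Unique-⊆-pair⇒length≤2 : ∀ {a b : A} {xs} → Unique xs → xs ⊆ a ∷ b ∷ [] → length xs ≤ 2
Unique-⊆-pair⇒length≤2 {xs = []}              _ _ = z≤n
Unique-⊆-pair⇒length≤2 {xs = _ ∷ []}          _ _ = s≤s z≤n
Unique-⊆-pair⇒length≤2 {xs = _ ∷ _ ∷ []}      _ _ = s≤s (s≤s z≤n)
Unique-⊆-pair⇒length≤2 {xs = x ∷ y ∷ z ∷ _} ((x≢y ∷ x≢z ∷ _) ∷ (y≢z ∷ _) ∷ _) xs⊆ab =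
  ⊥-elim (<-irrefl refl (∈-distinct₃⇒3≤length (xs⊆ab (here refl)) (xs⊆ab (there (here refl)))
                                              (xs⊆ab (there (there (here refl)))) x≢y x≢z y≢z))

Unique-lookup-injective : (xs : List A) → Unique xs → ∀ i j → toℕ i < toℕ j → lookup xs i ≢ lookup xs j
Unique-lookup-injective (x ∷ xs) (x∉xs ∷ _) 0F (1+ j) _ = All.lookup x∉xs (∈-lookup j)
Unique-lookup-injective (x ∷ xs) (_ ∷ uniq) (1+ i) (1+ j) (s≤s i<j) = Unique-lookup-injective xs uniq i j i<j

Unique⇒length≤ : (xs : List (Fin N)) → Unique xs → length xs ≤ N
Unique⇒length≤ {N} xs uniq with length xs ℕ.≤? N
... | yes xs≤N = xs≤N
... | no  xs≰N with i , j , i<j , same ← pigeonhole (≰⇒> xs≰N) (lookup xs) =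
  ⊥-elim (Unique-lookup-injective xs uniq i j i<j same)

module _ (H : Graph N) (π : Labeling N) where

  distinctWeights : List ℕ
  distinctWeights = deduplicate ℕ._≟_ (map (weight H π) (allFin N))

  weight∈distinctWeights : ∀ u → weight H π u ∈ distinctWeights
  weight∈distinctWeights u = ∈-deduplicate⁺ ℕ._≟_ (∈-map⁺ (weight H π) (∈-allFin u))

  edge⇒2≤numWeights : IsLDAL H π → ∀ {u v} → Adj H u v ≡ true → 2 ≤ numWeights H π
  edge⇒2≤numWeights ldal uv =
    ∈-distinct⇒2≤length (weight∈distinctWeights _) (weight∈distinctWeights _) (ldal _ _ uv)

  distinct₃⇒3≤numWeights : ∀ {u v x} → weight H π u ≢ weight H π v → weight H π u ≢ weight H π x →
                           weight H π v ≢ weight H π x → 3 ≤ numWeights H π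
  distinct₃⇒3≤numWeights =
    ∈-distinct₃⇒3≤length (weight∈distinctWeights _) (weight∈distinctWeights _) (weight∈distinctWeights _)

  twoValues⇒numWeights≤2 : ∀ {a b} → (∀ u → weight H π u ≡ a ⊎ weight H π u ≡ b) → numWeights H π ≤ 2
  twoValues⇒numWeights≤2 {a} {b} twoValues =
    Unique-⊆-pair⇒length≤2 (deduplicate-! _) (pair ∘ ∈-map⁻ (weight H π) ∘ ∈-deduplicate⁻ ℕ._≟_ _)
    where
    pair : ∀ {z} → ∃ (λ u → u ∈ allFin N × z ≡ weight H π u) → z ∈ a ∷ b ∷ []
    pair (u , _ , refl) with twoValues u
    ... | inj₁ refl = here refl
    ... | inj₂ refl = there (here refl)

does-true⇒ : ∀ {P : Set} (P? : Dec P) → does P? ≡ true → P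
does-true⇒ (yes p) _ = p

≡-does : ∀ {P : Set} {b} (P? : Dec P) → (b ≡ true → P) → (P → b ≡ true) → b ≡ does P?
≡-does             (yes p)  _   P⇒b = P⇒b p
≡-does {b = false} (no _)   _   _   = refl
≡-does {b = true}  (no ¬p)  b⇒P _   = ⊥-elim (¬p (b⇒P refl))

StarEdge : Fin m → Fin m → Fin m → Set
StarEdge c i j = i ≢ j × (i ≡ c ⊎ j ≡ c)

-- does (starEdge? c i j) is definitionally starAdj c i j.
starEdge? : (c i j : Fin m) → Dec (StarEdge c i j)
starEdge? c i j = ¬? (i ≟ᶠ j) ×-dec (i ≟ᶠ c ⊎-dec j ≟ᶠ c)

module _ (G : Graph m) where

  open import Data.List.Membership.DecPropositional (_≟ᶠ_ {m}) using (_∈?_)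

  adj-sym : ∀ {x y} → Adj G x y ≡ true → Adj G y x ≡ true
  adj-sym {x} {y} xy = ≡.trans (sym G y x) xy

  adj⇒≢ : ∀ {x y} → Adj G x y ≡ true → x ≢ y
  adj⇒≢ {x} xy refl with () ← ≡.trans (≡.sym xy) (irrefl G x)

  walk⇒edge : ∀ {x y} → Walk G x y → x ≢ y → ∃₂ λ u v → Adj G u v ≡ true
  walk⇒edge here         x≢x = ⊥-elim (x≢x refl)
  walk⇒edge (step xv _) _   = _ , _ , xv

  Pendant : Fin m → Fin m → Set
  Pendant ℓ c = Adj G ℓ c ≡ true × (∀ z → Adj G ℓ z ≡ true → z ≡ c)

  pendant-or-branch : ∀ {ℓ c} → Adj G ℓ c ≡ true → Pendant ℓ c ⊎ ∃ λ z → Adj G ℓ z ≡ true × z ≢ c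
  pendant-or-branch {ℓ} {c} ℓc with any? (λ z → (Adj G ℓ z ≟ᵇ true) ×-dec ¬? (z ≟ᶠ c))
  ... | yes branch    = inj₂ branch
  ... | no  no-branch = inj₁ (ℓc , only-c)
    where
    only-c : ∀ z → Adj G ℓ z ≡ true → z ≡ c
    only-c z ℓz with z ≟ᶠ c
    ... | yes z≡c = z≡c
    ... | no  z≢c = ⊥-elim (no-branch (z , ℓz , z≢c))

  PendantPath₃ : Fin m → Fin m → Fin m → Fin m → Set
  PendantPath₃ a b c d = Pendant a b × Adj G b c ≡ true × Adj G c d ≡ true × d ≢ b

  chain-prefix : ∀ {s w t} → w ∈ t → Unique (s ∷ t) → Chain G s t →
                 ∃₂ λ u vs → u ∷ vs ⊆ t × Unique (s ∷ u ∷ vs) × Chain G s (u ∷ vs) × lastOf u vs ≡ w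
  chain-prefix {t = u ∷ _} (here refl) ((s≢u ∷ _) ∷ _) (su , _) =
    u , [] , ∷⁺ʳ u (λ ()) , ((s≢u ∷ []) ∷ [] ∷ []) , (su , _) , refl
  chain-prefix {t = u ∷ _} (there w∈t) (s∉u∷t ∷ uniq) (su , chain)
    with u′ , vs , sub , uniq′ , chain′ , last ← chain-prefix w∈t uniq chain =
    u , u′ ∷ vs , ∷⁺ʳ u sub , (anti-mono (∷⁺ʳ u sub) s∉u∷t ∷ uniq′) , (su , chain′) , last

  chord⇒cycle : ∀ {h s t w} → Unique (h ∷ s ∷ t) → Chain G h (s ∷ t) → w ∈ t → Adj G w h ≡ true → HasCycle G
  chord⇒cycle {h} {s} (h∉s∷t ∷ uniq) (hs , chain) w∈t wh
    with u , vs , sub , uniq′ , chain′ , last ← chain-prefix w∈t uniq chain =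
    h , s ∷ u ∷ vs , s≤s (s≤s z≤n) , (anti-mono (∷⁺ʳ s sub) h∉s∷t ∷ uniq′) , (hs , chain′) ,
    subst (λ v → Adj G v h ≡ true) (≡.sym last) wh

  module _ (acyclic : ¬ HasCycle G) where

    pendant-or-extend : ∀ {h s t} → Unique (h ∷ s ∷ t) → Chain G h (s ∷ t) →
                        Pendant h s ⊎ ∃ λ z → Unique (z ∷ h ∷ s ∷ t) × Adj G z h ≡ true
    pendant-or-extend {h} {s} {t} uniq chain@(hs , _) with pendant-or-branch hs
    ... | inj₁ pendant = inj₁ pendant
    ... | inj₂ (z , hz , z≢s) with z ∈? h ∷ s ∷ t
    ...   | no  z∉                  = inj₂ (z , (¬Any⇒All¬ _ z∉ ∷ uniq) , adj-sym hz)
    ...   | yes (here refl)         = ⊥-elim (adj⇒≢ hz refl)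
    ...   | yes (there (here refl)) = ⊥-elim (z≢s refl)
    ...   | yes (there (there z∈t)) = ⊥-elim (acyclic (chord⇒cycle uniq chain z∈t (adj-sym hz)))

    pendant-from-path : ∀ k {h s t} → m ≤ k + length t → Unique (h ∷ s ∷ t) → Chain G h (s ∷ t) → ∃₂ Pendant
    pendant-from-path zero m≤t uniq _ =
      ⊥-elim (<-irrefl refl (≤-trans (≤-trans (n≤1+n _) (Unique⇒length≤ _ uniq)) m≤t))
    pendant-from-path (suc k) {h} {s} {t} m≤k+t uniq chain with pendant-or-extend uniq chain
    ... | inj₁ pendant          = h , s , pendant
    ... | inj₂ (z , uniq′ , zh) =
      pendant-from-path k (≤-trans m≤k+t (≤-reflexive (≡.sym (+-suc k (length t))))) uniq′ (zh , chain)

    acyclic⇒pendant : ∀ {x y} → Adj G x y ≡ true → ∃₂ Pendant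
    acyclic⇒pendant xy =
      pendant-from-path m (m≤m+n m 0) ((adj⇒≢ xy ∷ []) ∷ [] ∷ []) (xy , _)

  StarCentre : Fin m → Set
  StarCentre c = ∀ i j → Adj G i j ≡ starAdj c i j

  module _ {c} (centre : StarCentre c) where

    star-adj⇒edge : ∀ {i j} → Adj G i j ≡ true → StarEdge c i j
    star-adj⇒edge {i} {j} ij = does-true⇒ (starEdge? c i j) (≡.trans (≡.sym (centre i j)) ij)

    star-edge⇒adj : ∀ {i j} → StarEdge c i j → Adj G i j ≡ true
    star-edge⇒adj {i} {j} e = ≡.trans (centre i j) (dec-true (starEdge? c i j) e)

    star-leaf-pendant : ∀ {j} → j ≢ c → Pendant j c
    star-leaf-pendant j≢c = star-edge⇒adj (j≢c , inj₂ refl) , only-c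
      where
      only-c : ∀ z → Adj G _ z ≡ true → z ≡ c
      only-c z jz with star-adj⇒edge jz
      ... | _ , inj₁ j≡c = ⊥-elim (j≢c j≡c)
      ... | _ , inj₂ z≡c = z≡c

  pendant-neighbours⇒star : Connected G → ∀ c → (∀ {v} → Adj G c v ≡ true → Pendant v c) → StarCentre c
  pendant-neighbours⇒star connected c pendant i j =
    ≡-does (starEdge? c i j) adj⇒edge edge⇒adj
    where
    ball : ∀ {v w} → Walk G v w → v ≡ c ⊎ Adj G c v ≡ true → w ≡ c ⊎ Adj G c w ≡ true
    ball here           near        = near
    ball (step vu walk) (inj₁ refl) = ball walk (inj₂ vu)
    ball (step vu walk) (inj₂ cv)   = ball walk (inj₁ (proj₂ (pendant cv) _ vu))

    near : ∀ v → v ≡ c ⊎ Adj G c v ≡ true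
    near v = ball (connected c v) (inj₁ refl)

    adj⇒edge : Adj G i j ≡ true → StarEdge c i j
    adj⇒edge ij with near i
    ... | inj₁ i≡c = adj⇒≢ ij , inj₁ i≡c
    ... | inj₂ ci  = adj⇒≢ ij , inj₂ (proj₂ (pendant ci) j ij)

    edge⇒adj : StarEdge c i j → Adj G i j ≡ true
    edge⇒adj (i≢j , inj₁ refl) with near j
    ... | inj₁ refl = ⊥-elim (i≢j refl)
    ... | inj₂ cj   = cj
    edge⇒adj (i≢j , inj₂ refl) with near i
    ... | inj₁ refl = ⊥-elim (i≢j refl)
    ... | inj₂ ci   = adj-sym ci

  tree-without-pendantPath₃⇒star : IsTree G → (∀ {a b c d} → ¬ PendantPath₃ a b c d) →
                                   ∀ {x y} → x ≢ y → IsStar G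
  tree-without-pendantPath₃⇒star (connected , acyclic) no-path x≢y
    with _ , _ , uv ← walk⇒edge (connected _ _) x≢y
    with _ , c , ℓ-pendant ← acyclic⇒pendant acyclic uv =
    c , pendant-neighbours⇒star connected c neighbour-pendant
    where
    neighbour-pendant : ∀ {v} → Adj G c v ≡ true → Pendant v c
    neighbour-pendant cv with pendant-or-branch (adj-sym cv)
    ... | inj₁ pendant        = pendant
    ... | inj₂ (d , vd , d≢c) = ⊥-elim (no-path (ℓ-pendant , cv , vd , d≢c))

quotient-combine : ∀ (g : Fin m) (h : Fin n) → quotient n (combine g h) ≡ g
quotient-combine g h = cong proj₁ (remQuot-combine g h)

if-mono : ∀ {b b′ : Bool} x → (b ≡ true → b′ ≡ true) → (if b then x else 0) ≤ (if b′ then x else 0)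
if-mono {false} _ _    = z≤n
if-mono {true}  _ b⇒b′ rewrite b⇒b′ refl = ≤-refl

lex-adj-combine : (G : Graph m) → ∀ {g g′} → Adj G g g′ ≡ true →
                  ∀ (h h′ : Fin n) → Adj (lexEmpty G n) (combine g h) (combine g′ h′) ≡ true
lex-adj-combine G gg′ h h′ =
  subst₂ (λ x y → Adj G x y ≡ true) (≡.sym (quotient-combine _ h)) (≡.sym (quotient-combine _ h′)) gg′

module LexWeights (G : Graph m) (π : Labeling (m * n)) where

  lex : Graph (m * n)
  lex = lexEmpty G n

  fibreSum : Fin m → ℕ
  fibreSum g = sumFin n (λ h → label π (combine g h))

  baseWeight : Fin m → ℕ
  baseWeight g = sumFin m (λ g′ → if Adj G g g′ then fibreSum g′ else 0)

  weight-lex : ∀ u → weight lex π u ≡ baseWeight (quotient n u)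
  weight-lex u = begin
    sumFin (m * n) (λ x → if Adj G q (quotient n x) then label π x else 0)
      ≡⟨ sumFin-combine m n _ ⟩
    sumFin m (λ g → sumFin n (λ h → if Adj G q (quotient n (combine g h)) then label π (combine g h) else 0))
      ≡⟨ sumFin-cong m (λ g → sumFin-cong n (λ h → cong (λ g′ → if Adj G q g′ then label π (combine g h) else 0)
                                                       (quotient-combine g h))) ⟩
    sumFin m (λ g → sumFin n (λ h → if Adj G q g then label π (combine g h) else 0))
      ≡⟨ sumFin-cong m (λ g → sumFin-if n (Adj G q g) _) ⟩
    baseWeight q ∎
    where
    q = quotient n u
    open ≡.≡-Reasoning

  weight-combine : ∀ g h → weight lex π (combine g h) ≡ baseWeight g
  weight-combine g h = ≡.trans (weight-lex (combine g h)) (cong baseWeight (quotient-combine g h))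

  fibreSum-pos : Fin n → ∀ g → 0 < fibreSum g
  fibreSum-pos h g = <-≤-trans z<s (term≤sumFin n _ h)

  neighbour-fibreSum≤baseWeight : ∀ {g g′} → Adj G g g′ ≡ true → fibreSum g′ ≤ baseWeight g
  neighbour-fibreSum≤baseWeight {g} {g′} gg′ =
    ≤-trans (≤-reflexive (cong (λ b → if b then fibreSum g′ else 0) (≡.sym gg′))) (term≤sumFin m _ g′)

  pendant-baseWeight : ∀ {ℓ c} → Pendant G ℓ c → baseWeight ℓ ≡ fibreSum c
  pendant-baseWeight {ℓ} {c} (ℓc , only-c) =
    ≡.trans (sumFin-single m _ c off-c) (cong (λ b → if b then fibreSum c else 0) ℓc)
    where
    off-c : ∀ g → g ≢ c → (if Adj G ℓ g then fibreSum g else 0) ≡ 0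
    off-c g g≢c with Adj G ℓ g in ℓg
    ... | false = refl
    ... | true  = ⊥-elim (g≢c (only-c g ℓg))

  ⊂-neighbourhood⇒baseWeight< : ∀ {a c d} → (∀ g → Adj G a g ≡ true → Adj G c g ≡ true) →
                                Adj G a d ≡ false → Adj G c d ≡ true → Fin n → baseWeight a < baseWeight c
  ⊂-neighbourhood⇒baseWeight< {d = d} a⊆c ad cd h =
    sumFin-mono-< m (λ g → if-mono (fibreSum g) (a⊆c g)) d
      (subst₂ (λ x y → (if x then fibreSum d else 0) < (if y then fibreSum d else 0)) (≡.sym ad) (≡.sym cd)
              (fibreSum-pos h d))

  pendantPath₃⇒3≤numWeights : IsLDAL lex π → Fin n → ∀ {a b c d} → PendantPath₃ G a b c d →
                              3 ≤ numWeights lex π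
  pendantPath₃⇒3≤numWeights ldal h {a} {b} {c} {d} ((ab , only-b) , bc , cd , d≢b) =
    distinct₃⇒3≤numWeights lex π (ldal _ _ (lex-adj-combine G ab h h)) a≢c
                                 (ldal _ _ (lex-adj-combine G bc h h))
    where
    a⊆c : ∀ g → Adj G a g ≡ true → Adj G c g ≡ true
    a⊆c g ag = subst (λ x → Adj G c x ≡ true) (≡.sym (only-b g ag)) (adj-sym G bc)

    a≢c : weight lex π (combine a h) ≢ weight lex π (combine c h)
    a≢c a≡c = <⇒≢ (⊂-neighbourhood⇒baseWeight< a⊆c (¬-not (d≢b ∘ only-b d)) cd h)
                  (≡.trans (≡.sym (weight-combine a h)) (≡.trans a≡c (weight-combine c h)))

  proper⇒ldal : (∀ {g g′} → Adj G g g′ ≡ true → baseWeight g ≢ baseWeight g′) → IsLDAL lex π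
  proper⇒ldal proper u v uv uv≡ =
    proper uv (≡.trans (≡.sym (weight-lex u)) (≡.trans uv≡ (weight-lex v)))

chiLd≡2⇒no-pendantPath₃ : (G : Graph m) → ChiLdIs (lexEmpty G n) 2 → Fin n →
                          ∀ {a b c d} → ¬ PendantPath₃ G a b c d
chiLd≡2⇒no-pendantPath₃ G ((π , ldal , two) , _) h path =
  <-irrefl refl (subst (3 ≤_) two (LexWeights.pendantPath₃⇒3≤numWeights G π ldal h path))

liftFibres : Permutation′ m → Permutation′ (m * n)
liftFibres σ = ↔-trans *↔× (↔-trans (σ ×-↔ ↔-refl) (↔-sym *↔×))

liftFibres-combine : ∀ (σ : Permutation′ m) g (h : Fin n) →
                     liftFibres σ ⟨$⟩ʳ combine g h ≡ combine (σ ⟨$⟩ʳ g) h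
liftFibres-combine σ g h = cong (λ p → combine (σ ⟨$⟩ʳ proj₁ p) (proj₂ p)) (remQuot-combine g h)

module StarLabelling {m n : ℕ} (G : Graph (suc m)) {c} (centre : StarCentre G c) where

  -- The fibre of the centre receives the smallest labels 1, …, n.
  centreFirst : Labeling (suc m * n)
  centreFirst = liftFibres (transpose c 0F)

  open LexWeights G centreFirst

  centre↦0 : transpose c 0F ⟨$⟩ʳ c ≡ 0F
  centre↦0 rewrite dec-true (c ≟ᶠ c) refl = refl

  leaf↦positive : ∀ {j} → j ≢ c → 0F {m} <ᶠ transpose c 0F ⟨$⟩ʳ j
  leaf↦positive {j} j≢c with transpose c 0F ⟨$⟩ʳ j in j↦
  ... | 1+ _ = s≤s z≤n
  ... | 0F   = ⊥-elim (j≢c (begin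
    j                                           ≡⟨ inverseˡ (transpose c 0F) ⟨
    transpose c 0F ⟨$⟩ˡ (transpose c 0F ⟨$⟩ʳ j) ≡⟨ cong (transpose c 0F ⟨$⟩ˡ_) (≡.trans j↦ (≡.sym centre↦0)) ⟩
    transpose c 0F ⟨$⟩ˡ (transpose c 0F ⟨$⟩ʳ c) ≡⟨ inverseˡ (transpose c 0F) ⟩
    c                                           ∎))
    where open ≡.≡-Reasoning

  centre-label< : ∀ {j} → j ≢ c → ∀ h → label centreFirst (combine c h) < label centreFirst (combine j h)
  centre-label< {j} j≢c h
    rewrite liftFibres-combine {n = n} (transpose c 0F) c h
          | liftFibres-combine {n = n} (transpose c 0F) j h
          | centre↦0 =
    s≤s (combine-monoˡ-< h h (leaf↦positive j≢c))

  leaf-baseWeight : ∀ {j} → j ≢ c → baseWeight j ≡ fibreSum c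
  leaf-baseWeight j≢c = pendant-baseWeight (star-leaf-pendant G centre j≢c)

  leaf<centre : ∀ {j} → j ≢ c → Fin n → baseWeight j < baseWeight c
  leaf<centre {j} j≢c h = begin-strict
    baseWeight j ≡⟨ leaf-baseWeight j≢c ⟩
    fibreSum c   <⟨ sumFin-mono-< n (λ h′ → <⇒≤ (centre-label< j≢c h′)) h (centre-label< j≢c h) ⟩
    fibreSum j   ≤⟨ neighbour-fibreSum≤baseWeight (star-edge⇒adj G centre (j≢c ∘ ≡.sym , inj₁ refl)) ⟩
    baseWeight c ∎
    where open ≤-Reasoning

  baseWeight-proper : Fin n → ∀ {g g′} → Adj G g g′ ≡ true → baseWeight g ≢ baseWeight g′
  baseWeight-proper h gg′ with star-adj⇒edge G centre gg′
  ... | g≢g′ , inj₁ refl = ≢-sym (<⇒≢ (leaf<centre (g≢g′ ∘ ≡.sym) h))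
  ... | g≢g′ , inj₂ refl = <⇒≢ (leaf<centre g≢g′ h)

  centreFirst-twoValues : ∀ u → weight lex centreFirst u ≡ baseWeight c ⊎
                                weight lex centreFirst u ≡ fibreSum c
  centreFirst-twoValues u with quotient n u ≟ᶠ c
  ... | yes q≡c = inj₁ (≡.trans (weight-lex u) (cong baseWeight q≡c))
  ... | no  q≢c = inj₂ (≡.trans (weight-lex u) (leaf-baseWeight q≢c))

  star⇒chiLd≡2 : ∀ {j} → j ≢ c → Fin n → ChiLdIs lex 2
  star⇒chiLd≡2 j≢c h =
    (centreFirst , ldal , ≤-antisym (twoValues⇒numWeights≤2 lex centreFirst centreFirst-twoValues)
                                    (2≤ centreFirst ldal)) ,
    2≤
    where
    ldal : IsLDAL lex centreFirst
    ldal = proper⇒ldal (baseWeight-proper h)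

    2≤ : ∀ π → IsLDAL lex π → 2 ≤ numWeights lex π
    2≤ π ldal = edge⇒2≤numWeights lex π ldal
                  (lex-adj-combine G (star-edge⇒adj G centre (j≢c ∘ ≡.sym , inj₁ refl)) h h)

mainTheorem11 : (n m : ℕ) → 1 < n → 3 ≤ m → (G : Graph m) → IsTree G → ChiLdIs (lexEmpty G n) 2 ⇔ IsStar G
mainTheorem11 (suc n) (suc (suc m)) (s≤s _) (s≤s (s≤s _)) G tree = mk⇔
  (λ chiLd≡2 → tree-without-pendantPath₃⇒star G tree (chiLd≡2⇒no-pendantPath₃ G chiLd≡2 0F) {0F} {1+ 0F} (λ ()))
  (λ (c , centre) → StarLabelling.star⇒chiLd≡2 G centre (punchInᵢ≢i c 0F) 0F)
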